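{- Let $a$ be a positive integer such that $a$ is a primitive root modulo $p$ for infinitely many primes $p$, and let $S = \{a^k : k \in \mathbb{N}\}$. Let $f: \mathbb{N} \to \mathbb{Z}_{\geq 0}$ be non-decreasing and unbounded. Then there exists a subset $A \subseteq S$ such that $|A \cap \{1, \dots, N\}| \leq f(N)$ for all $N \in \mathbb{N}$ and such that there does not exist an $n \in \mathbb{Z}$ with $A + n = \{x + n : x \in A\}$ contained in the set of (positive) primes. In particular, there is no non-decreasing, unbounded function $f: \mathbb{N} \to \mathbb{Z}_{\geq 0}$ with the property that every admissible set $A \subseteq \mathbb{N}$ satisfying $|A \cap \{1, \dots, N\}| \leq f(N)$ for all $N$ admits some $n \in \mathbb{Z}$ such that $A + n$ is contained in the primes.
   Context: $\mathbb{N}$ denotes the positive integers. A set $A \subseteq \mathbb{N}$ is called admissible if there is no prime $p$ such that $A$ contains at least one element in each residue class modulo $p$. Primes are taken to be positive. An integer $a$ is a primitive root modulo a prime $p$ if its residue generates the multiplicative group $(\mathbb{Z}/p\mathbb{Z})^\times$. (It is a known result that at least one positive integer $a$ is a primitive root modulo infinitely many primes.) -}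

module Defs where

open import Data.Nat using (ℕ; zero; suc; _+_; _*_; _^_; _≤_; _<_; ∣_-_∣)
open import Data.Nat.Divisibility using (_∣_)
open import Data.Nat.Primality using (Prime)
open import Data.Bool using (Bool; true; false; if_then_else_)
open import Data.Integer as ℤ using (ℤ; +_)
open import Data.Product using (Σ; ∃; _×_; _,_)
open import Relation.Binary.PropositionalEquality using (_≡_; _≢_)
open import Relation.Nullary using (¬_)

ModEq : ℕ → ℕ → ℕ → Set
ModEq p x y = p ∣ ∣ x - y ∣

SetN : Set
SetN = ℕ → Bool

IsPrimitiveRoot : ℕ → ℕ → Set
IsPrimitiveRoot a p =
  ¬ ModEq p a 0 ×
  (∀ x → ¬ ModEq p x 0 → ∃ λ k → ModEq p (a ^ k) x)

PrimRootInfOften : ℕ → Set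
PrimRootInfOften a = ∀ M → ∃ λ p → M < p × Prime p × IsPrimitiveRoot a p

count : SetN → ℕ → ℕ
count A zero = 0
count A (suc N) = (if A (suc N) then 1 else 0) + count A N

-- f : ℕ → ℤ≥0 (only values on positive arguments matter) non-decreasing, unbounded
NonDecreasing : (ℕ → ℕ) → Set
NonDecreasing f = ∀ m n → 1 ≤ m → m ≤ n → f m ≤ f n

Unbounded : (ℕ → ℕ) → Set
Unbounded f = ∀ B → ∃ λ N → 1 ≤ N × B < f N

CountBounded : SetN → (ℕ → ℕ) → Set
CountBounded A f = ∀ N → 1 ≤ N → count A N ≤ f N

-- A ⊆ S = {a^k : k ∈ ℕ} (ℕ the positive integers); also A ⊆ ℕ positive
SubsetOfPowers : ℕ → SetN → Set
SubsetOfPowers a A = ∀ x → A x ≡ true → ∃ λ k → 1 ≤ k × x ≡ a ^ k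

PositiveSet : SetN → Set
PositiveSet A = A 0 ≡ false

IsPrimeℤ : ℤ → Set
IsPrimeℤ z = ∃ λ m → z ≡ + m × Prime m

ShiftIntoPrimes : SetN → ℤ → Set
ShiftIntoPrimes A n = ∀ x → A x ≡ true → IsPrimeℤ (+ x ℤ.+ n)

Admissible : SetN → Set
Admissible A = ¬ (∃ λ p → Prime p ×
  (∀ r → r < p → ∃ λ x → A x ≡ true × ModEq p x r))

{-# OPTIONS --safe #-}
-- Enumerate the integers as n₀, n₁, …  For n_j ≠ 0 take a prime p > |n_j| modulo which a is
-- a primitive root: then a^k ≡ -n_j (mod p) for arbitrarily large k, and for such k the number
-- a^k + n_j is a proper multiple of p, hence not prime (for n_j = 0 any a^k with k ≥ 2 will do).
-- Choosing exponents k₀ < k₁ < … with f(a^{k_j}) > j, the set A = {a^{k_j}} has at most j + 1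
-- elements up to a^{k_j}, and A + n_j is never contained in the primes.  Every set of positive
-- powers of a is admissible: it misses the class 0 modulo each prime not dividing a, and the
-- class 1 modulo each prime dividing a.
module Submission where

open import Defs
open import Data.Bool using (true; false)
open import Data.Bool.Properties using (¬-not)
open import Data.Fin using (toℕ; fromℕ<)
open import Data.Fin.Properties using (pigeonhole; fromℕ<-injective)
open import Data.Integer as ℤ using (ℤ; +_; -[1+_])
import Data.Integer.Properties as ℤₚ
open import Data.Nat
open import Data.Nat.Properties
open import Data.Nat.Divisibility
open import Data.Nat.DivMod
open import Data.Nat.Primality
open import Data.Product using (∃; _×_; _,_; proj₁; proj₂)
open import Data.Sum using (inj₁; inj₂)
open import Function using (_∘_)
open import Relation.Nullary using (¬_; contradiction; does; yes; no)
open import Relation.Nullary.Decidable using (dec-true)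
open import Relation.Binary.PropositionalEquality

private
  variable
    a c d m n p s t x y : ℕ

prime>1 : Prime p → 1 < p
prime>1 {p} pp = nonTrivial⇒n>1 p {{prime⇒nonTrivial pp}}

prime∤1 : Prime p → ¬ p ∣ 1
prime∤1 pp p∣1 = <-irrefl (sym (∣1⇒≡1 p∣1)) (prime>1 pp)

prime∣^⇒∣ : Prime p → ∀ n → p ∣ m ^ n → p ∣ m
prime∣^⇒∣ pp zero    p∣1      = contradiction p∣1 (prime∤1 pp)
prime∣^⇒∣ pp (suc n) p∣m*mⁿ with euclidsLemma _ _ pp p∣m*mⁿ
... | inj₁ p∣m  = p∣m
... | inj₂ p∣mⁿ = prime∣^⇒∣ pp n p∣mⁿ

¬prime-of-proper-divisor : 1 < d → d ∣ m → d < m → ¬ Prime m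
¬prime-of-proper-divisor 1<d d∣m d<m pm with prime⇒irreducible pm d∣m
... | inj₁ refl = <-irrefl refl 1<d
... | inj₂ refl = <-irrefl refl d<m

isPrimeℤ⇒prime : IsPrimeℤ (+ m) → Prime m
isPrimeℤ⇒prime (q , m≡q , pq) = subst Prime (sym (ℤₚ.+-injective m≡q)) pq

n<m^n : 1 < m → ∀ n → n < m ^ n
n<m^n 1<m zero    = z<s
n<m^n 1<m (suc n) = ≤-<-trans (n<m^n 1<m n) (^-monoʳ-< _ 1<m (n<1+n n))

modEq-0⇒∣ : ModEq p x 0 → p ∣ x
modEq-0⇒∣ {p} {x} = subst (p ∣_) (∣-∣-identityʳ x)

∣⇒modEq-0 : p ∣ x → ModEq p x 0
∣⇒modEq-0 {p} {x} = subst (p ∣_) (sym (∣-∣-identityʳ x))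

∣∸⇒%≡ : .{{_ : NonZero p}} → y ≤ x → p ∣ x ∸ y → x % p ≡ y % p
∣∸⇒%≡ {p} {y} {x} y≤x (divides q x∸y≡qp) = begin
  x % p               ≡⟨ cong (_% p) (m+[n∸m]≡n y≤x) ⟨
  (y + (x ∸ y)) % p   ≡⟨ cong (λ w → (y + w) % p) x∸y≡qp ⟩
  (y + q * p) % p     ≡⟨ [m+kn]%n≡m%n y q p ⟩
  y % p               ∎
  where open ≡-Reasoning

%≡⇒∣∸ : .{{_ : NonZero p}} → y ≤ x → x % p ≡ y % p → p ∣ x ∸ y
%≡⇒∣∸ {p} {y} {x} y≤x x%p≡y%p = divides (x / p ∸ y / p) (begin
  x ∸ y                                       ≡⟨ cong₂ _∸_ (m≡m%n+[m/n]*n x p) (m≡m%n+[m/n]*n y p) ⟩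
  (x % p + x / p * p) ∸ (y % p + y / p * p)   ≡⟨ cong (λ r → (r + x / p * p) ∸ (y % p + y / p * p)) x%p≡y%p ⟩
  (y % p + x / p * p) ∸ (y % p + y / p * p)   ≡⟨ [m+n]∸[m+o]≡n∸o (y % p) _ _ ⟩
  x / p * p ∸ y / p * p                       ≡⟨ *-distribʳ-∸ p (x / p) (y / p) ⟨
  (x / p ∸ y / p) * p                         ∎)
  where open ≡-Reasoning

modEq⇒%≡ : .{{_ : NonZero p}} → ModEq p x y → x % p ≡ y % p
modEq⇒%≡ {p} {x} {y} p∣∣x-y∣ with ≤-total y x
... | inj₁ y≤x = ∣∸⇒%≡ y≤x (subst (p ∣_) (m≤n⇒∣n-m∣≡n∸m y≤x) p∣∣x-y∣)
... | inj₂ x≤y = sym (∣∸⇒%≡ x≤y (subst (p ∣_) (m≤n⇒∣m-n∣≡n∸m x≤y) p∣∣x-y∣))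

%≡⇒modEq : .{{_ : NonZero p}} → x % p ≡ y % p → ModEq p x y
%≡⇒modEq {p} {x} {y} x%p≡y%p with ≤-total y x
... | inj₁ y≤x = subst (p ∣_) (sym (m≤n⇒∣n-m∣≡n∸m y≤x)) (%≡⇒∣∸ y≤x x%p≡y%p)
... | inj₂ x≤y = subst (p ∣_) (sym (m≤n⇒∣m-n∣≡n∸m x≤y)) (%≡⇒∣∸ x≤y (sym x%p≡y%p))

%-cong-+ʳ : .{{_ : NonZero p}} → ∀ z → x % p ≡ y % p → (x + z) % p ≡ (y + z) % p
%-cong-+ʳ {p} {x} {y} z x%p≡y%p = begin
  (x + z) % p               ≡⟨ %-distribˡ-+ x z p ⟩
  (x % p + z % p) % p       ≡⟨ cong (λ r → (r + z % p) % p) x%p≡y%p ⟩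
  (y % p + z % p) % p       ≡⟨ %-distribˡ-+ y z p ⟨
  (y + z) % p               ∎
  where open ≡-Reasoning

%-cong-*ʳ : .{{_ : NonZero p}} → ∀ z → x % p ≡ y % p → (x * z) % p ≡ (y * z) % p
%-cong-*ʳ {p} {x} {y} z x%p≡y%p = begin
  (x * z) % p               ≡⟨ %-distribˡ-* x z p ⟩
  ((x % p) * (z % p)) % p   ≡⟨ cong (λ r → (r * (z % p)) % p) x%p≡y%p ⟩
  ((y % p) * (z % p)) % p   ≡⟨ %-distribˡ-* y z p ⟨
  (y * z) % p               ∎
  where open ≡-Reasoning

%-cancel-*ˡ : .{{_ : NonZero p}} → Prime p → ¬ p ∣ c → (c * x) % p ≡ (c * y) % p → x % p ≡ y % p
%-cancel-*ˡ {p} {c} {x} {y} pp p∤c cx≡cy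
  with euclidsLemma c ∣ x - y ∣ pp (subst (p ∣_) (sym (*-distribˡ-∣-∣ c x y)) (%≡⇒modEq cx≡cy))
... | inj₁ p∣c    = contradiction p∣c p∤c
... | inj₂ p∣∣x-y∣ = modEq⇒%≡ p∣∣x-y∣

-- Pigeonhole on the residues of a⁰, …, aᵖ gives aⁱ ≡ aʲ with i < j; then cancel aⁱ.
positive-order : .{{_ : NonZero p}} → Prime p → ¬ p ∣ a → ∃ λ s → 0 < s × a ^ s % p ≡ 1 % p
positive-order {p} {a} pp p∤a
  with i , j , i<j , aⁱ≡aʲ ← pigeonhole (n<1+n p) (λ i → fromℕ< (m%n<n (a ^ toℕ i) p))
  = toℕ j ∸ toℕ i , m<n⇒0<n∸m i<j , %-cancel-*ˡ pp (p∤a ∘ prime∣^⇒∣ pp (toℕ i)) (begin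
    (a ^ toℕ i * a ^ (toℕ j ∸ toℕ i)) % p   ≡⟨ cong (_% p) (^-distribˡ-+-* a (toℕ i) _) ⟨
    a ^ (toℕ i + (toℕ j ∸ toℕ i)) % p       ≡⟨ cong (λ e → a ^ e % p) (m+[n∸m]≡n (<⇒≤ i<j)) ⟩
    a ^ toℕ j % p                           ≡⟨ fromℕ<-injective _ _ _ _ aⁱ≡aʲ ⟨
    a ^ toℕ i % p                           ≡⟨ cong (_% p) (*-identityʳ _) ⟨
    (a ^ toℕ i * 1) % p                     ∎)
  where open ≡-Reasoning

^-%-periodic : .{{_ : NonZero p}} → ∀ a → a ^ s % p ≡ 1 % p → ∀ m k → a ^ (m * s + k) % p ≡ a ^ k % p
^-%-periodic a aˢ≡1 zero    k = refl
^-%-periodic {p} {s} a aˢ≡1 (suc m) k = begin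
  a ^ ((s + m * s) + k) % p       ≡⟨ cong (λ e → a ^ e % p) (+-assoc s (m * s) k) ⟩
  a ^ (s + (m * s + k)) % p       ≡⟨ cong (_% p) (^-distribˡ-+-* a s (m * s + k)) ⟩
  (a ^ s * a ^ (m * s + k)) % p   ≡⟨ %-cong-*ʳ (a ^ (m * s + k)) aˢ≡1 ⟩
  (1 * a ^ (m * s + k)) % p       ≡⟨ cong (_% p) (*-identityˡ _) ⟩
  a ^ (m * s + k) % p             ≡⟨ ^-%-periodic a aˢ≡1 m k ⟩
  a ^ k % p                       ∎
  where open ≡-Reasoning

primitiveRoot-hits-late : .{{_ : NonZero p}} → Prime p → IsPrimitiveRoot a p → ¬ p ∣ t →
                          ∀ B → ∃ λ k → B ≤ k × a ^ k % p ≡ t % p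
primitiveRoot-hits-late {p} {a} {t} pp (p∤a , generates) p∤t B
  with k₀ , aᵏ⁰≡t ← generates t (p∤t ∘ modEq-0⇒∣)
     | s , 0<s , aˢ≡1 ← positive-order pp (p∤a ∘ ∣⇒modEq-0)
  = B * s + k₀ , ≤-trans (m≤m*n B s {{>-nonZero 0<s}}) (m≤m+n _ k₀)
  , trans (^-%-periodic a aˢ≡1 B k₀) (modEq⇒%≡ aᵏ⁰≡t)

∣-resp-modEq : .{{_ : NonZero p}} → ModEq p x y → p ∣ x → p ∣ y
∣-resp-modEq {p} {x} {y} x≡y p∣x =
  m%n≡0⇒n∣m y p (trans (sym (modEq⇒%≡ x≡y)) (n∣m⇒m%n≡0 x p p∣x))

module _ {a : ℕ} (1<a : 1 < a) where

  power-plus-not-prime : Prime p → IsPrimitiveRoot a p → suc s < p → ∀ L →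
                         ∃ λ k → L ≤ k × ¬ Prime (a ^ k + suc s)
  power-plus-not-prime {p} {s} pp root s<p L = conclude (primitiveRoot-hits-late pp root p∤r (L + p))
    where
    instance _ = prime⇒nonZero pp
    r : ℕ
    r = p ∸ suc s
    p∤r : ¬ p ∣ r
    p∤r = >⇒∤ {{>-nonZero (m<n⇒0<n∸m s<p)}} (∸-monoʳ-< z<s (<⇒≤ s<p))
    conclude : (∃ λ k → L + p ≤ k × a ^ k % p ≡ r % p) → ∃ λ k → L ≤ k × ¬ Prime (a ^ k + suc s)
    conclude (k , L+p≤k , aᵏ≡r) =
      k , ≤-trans (m≤m+n L p) L+p≤k , ¬prime-of-proper-divisor (prime>1 pp) p∣aᵏ+s p<aᵏ+s
      where
      p∣aᵏ+s : p ∣ a ^ k + suc s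
      p∣aᵏ+s = m%n≡0⇒n∣m _ p (begin
        (a ^ k + suc s) % p   ≡⟨ %-cong-+ʳ {x = a ^ k} (suc s) aᵏ≡r ⟩
        (r + suc s) % p       ≡⟨ cong (_% p) (m∸n+n≡m (<⇒≤ s<p)) ⟩
        p % p                 ≡⟨ n%n≡0 p ⟩
        0                     ∎)
        where open ≡-Reasoning
      p<aᵏ+s : p < a ^ k + suc s
      p<aᵏ+s = <-≤-trans (≤-<-trans (≤-trans (m≤n+m p L) L+p≤k) (n<m^n 1<a k)) (m≤m+n _ _)

  power-minus-not-prime : Prime p → IsPrimitiveRoot a p → suc s < p → ∀ L →
                          ∃ λ k → L ≤ k × suc s ≤ a ^ k × ¬ Prime (a ^ k ∸ suc s)
  power-minus-not-prime {p} {s} pp root s<p L =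
    conclude (primitiveRoot-hits-late pp root (>⇒∤ s<p) (L + (p + suc s)))
    where
    instance _ = prime⇒nonZero pp
    conclude : (∃ λ k → L + (p + suc s) ≤ k × a ^ k % p ≡ suc s % p) →
               ∃ λ k → L ≤ k × suc s ≤ a ^ k × ¬ Prime (a ^ k ∸ suc s)
    conclude (k , B≤k , aᵏ≡s) = k , ≤-trans (m≤m+n L _) B≤k , s≤aᵏ
      , ¬prime-of-proper-divisor (prime>1 pp) (%≡⇒∣∸ s≤aᵏ aᵏ≡s) (m+n≤o⇒m≤o∸n (suc p) p+s<aᵏ)
      where
      p+s<aᵏ : p + suc s < a ^ k
      p+s<aᵏ = ≤-<-trans (≤-trans (m≤n+m _ L) B≤k) (n<m^n 1<a k)
      s≤aᵏ : suc s ≤ a ^ k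
      s≤aᵏ = ≤-trans (m≤n+m (suc s) p) (<⇒≤ p+s<aᵏ)

  power-shift-not-prime : PrimRootInfOften a → ∀ n L → ∃ λ k → L ≤ k × ¬ IsPrimeℤ (+ (a ^ k) ℤ.+ n)
  power-shift-not-prime roots (+ zero) L =
    2 + L , m≤n+m L 2 , aᵏ-not-prime ∘ subst Prime (+-identityʳ _) ∘ isPrimeℤ⇒prime
    where
    a<aᵏ : a < a ^ (2 + L)
    a<aᵏ = subst (_< a ^ (2 + L)) (^-identityʳ a) (^-monoʳ-< a 1<a {1} {2 + L} (s<s z<s))
    aᵏ-not-prime : ¬ Prime (a ^ (2 + L))
    aᵏ-not-prime = ¬prime-of-proper-divisor 1<a (m∣m*n (a ^ suc L)) a<aᵏ
  power-shift-not-prime roots (+ suc s) L with p , s<p , pp , root ← roots (suc s)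
    with k , L≤k , not-prime ← power-plus-not-prime pp root s<p L
    = k , L≤k , not-prime ∘ isPrimeℤ⇒prime
  power-shift-not-prime roots -[1+ s ] L with p , s<p , pp , root ← roots (suc s)
    with k , L≤k , s≤aᵏ , not-prime ← power-minus-not-prime pp root s<p L
    = k , L≤k , not-prime ∘ isPrimeℤ⇒prime ∘ subst IsPrimeℤ (ℤₚ.⊖-≥ s≤aᵏ)

primRootInfOften⇒1<a : 1 ≤ a → PrimRootInfOften a → 1 < a
primRootInfOften⇒1<a {suc (suc a)} _ _ = s<s z<s
primRootInfOften⇒1<a {suc zero} _ roots with p , 2<p , pp , _ , generates ← roots 2
  with k , 1ᵏ≡2 ← generates 2 (>⇒∤ 2<p ∘ modEq-0⇒∣)
  = contradiction (subst (λ z → p ∣ ∣ z - 2 ∣) (^-zeroˡ k) 1ᵏ≡2) (prime∤1 pp)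

powers-admissible : ∀ {A} → SubsetOfPowers a A → Admissible A
powers-admissible {a} ⊆powers (p , pp , meets)
  with x₀ , x₀∈A , x₀≡0 ← meets 0 (<-trans z<s (prime>1 pp))
     | x₁ , x₁∈A , x₁≡1 ← meets 1 (prime>1 pp)
  with k₀ , _ , refl ← ⊆powers x₀ x₀∈A
     | suc k₁ , _ , refl ← ⊆powers x₁ x₁∈A
  = prime∤1 pp (∣-resp-modEq {y = 1} {{prime⇒nonZero pp}} x₁≡1 p∣aᵏ¹)
  where
  p∣aᵏ¹ : p ∣ a ^ suc k₁
  p∣aᵏ¹ = ∣-trans (prime∣^⇒∣ pp k₀ (modEq-0⇒∣ x₀≡0)) (m∣m*n _)

-- Searching j ≤ x suffices for increasing g, where j ≤ g j.
range : (ℕ → ℕ) → SetN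
range g x = does (anyUpTo? (λ j → g j ≟ x) (suc x))

range-sound : ∀ g → range g x ≡ true → ∃ λ j → g j ≡ x
range-sound {x} g x∈ with anyUpTo? (λ j → g j ≟ x) (suc x)
range-sound g _  | yes (j , _ , gj≡x) = j , gj≡x
range-sound g () | no _

count-bounded-by-members : ∀ {A f} → NonDecreasing f → (∀ x → A x ≡ true → count A x ≤ f x) →
                           CountBounded A f
count-bounded-by-members {A} f-mono members (suc N) _ with A (suc N) | members (suc N)
... | true  | bound = bound refl
... | false | _ with N
...   | zero   = z≤n
...   | suc N′ = ≤-trans (count-bounded-by-members f-mono members (suc N′) z<s) (f-mono _ _ z<s (n≤1+n _))

module _ {g : ℕ → ℕ} (g-inc : ∀ j → g j < g (suc j)) where

  increasing⇒monotone : m ≤ n → g m ≤ g n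
  increasing⇒monotone = monotone′ ∘ ≤⇒≤′
    where
    monotone′ : m ≤′ n → g m ≤ g n
    monotone′ ≤′-refl        = ≤-refl
    monotone′ (≤′-step m≤′n) = ≤-trans (monotone′ m≤′n) (<⇒≤ (g-inc _))

  increasing⇒reflects-< : g m < g n → m < n
  increasing⇒reflects-< gm<gn = ≰⇒> (<⇒≱ gm<gn ∘ increasing⇒monotone)

  n≤g[n] : ∀ n → n ≤ g n
  n≤g[n] zero    = z≤n
  n≤g[n] (suc n) = ≤-<-trans (n≤g[n] n) (g-inc n)

  range-complete : ∀ j → range g (g j) ≡ true
  range-complete j = dec-true (anyUpTo? (λ i → g i ≟ g j) (suc (g j))) (j , s≤s (n≤g[n] j) , refl)

  count-range : ∀ {N j} → N < g j → count (range g) N ≤ j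
  count-range {zero}      _      = z≤n
  count-range {suc N} {j} sN<gj with range g (suc N) in sN∈
  ... | false = count-range (<-trans (n<1+n N) sN<gj)
  ... | true with i , gi≡sN ← range-sound g sN∈
    = <-≤-trans (s≤s (count-range (subst (N <_) (sym gi≡sN) (n<1+n N))))
                (increasing⇒reflects-< (subst (_< g j) (sym gi≡sN) sN<gj))

increasing-choice : {P : ℕ → ℕ → Set} → (∀ j L → ∃ λ k → L ≤ k × P j k) → (b : ℕ → ℕ) →
                    ∃ λ (k : ℕ → ℕ) → (∀ j → k j < k (suc j)) × (∀ j → b j ≤ k j) ×
                                      (∀ j → P j (k j))
increasing-choice {P} choose b = k , k-inc , b≤k , P-k
  where
  mutual
    lowerBound : ℕ → ℕ
    lowerBound zero    = b zero
    lowerBound (suc j) = b (suc j) + suc (k j)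

    k : ℕ → ℕ
    k j = proj₁ (choose j (lowerBound j))

  lowerBound≤k : ∀ j → lowerBound j ≤ k j
  lowerBound≤k j = proj₁ (proj₂ (choose j (lowerBound j)))

  k-inc : ∀ j → k j < k (suc j)
  k-inc j = ≤-trans (m≤n+m _ _) (lowerBound≤k (suc j))

  b≤k : ∀ j → b j ≤ k j
  b≤k zero    = lowerBound≤k zero
  b≤k (suc j) = ≤-trans (m≤m+n _ _) (lowerBound≤k (suc j))

  P-k : ∀ j → P j (k j)
  P-k j = proj₂ (proj₂ (choose j (lowerBound j)))

awayFromZero : ℤ → ℤ
awayFromZero (+ n)    = + suc n
awayFromZero -[1+ n ] = -[1+ suc n ]

enumℤ : ℕ → ℤ
enumℤ zero          = + 0
enumℤ (suc zero)    = -[1+ 0 ]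
enumℤ (suc (suc j)) = awayFromZero (enumℤ j)

indexℤ : ℤ → ℕ
indexℤ (+ zero)       = 0
indexℤ (+ suc n)      = 2 + indexℤ (+ n)
indexℤ -[1+ zero ]    = 1
indexℤ -[1+ suc n ]   = 2 + indexℤ -[1+ n ]

enumℤ-indexℤ : ∀ n → enumℤ (indexℤ n) ≡ n
enumℤ-indexℤ (+ zero)     = refl
enumℤ-indexℤ (+ suc n)    = cong awayFromZero (enumℤ-indexℤ (+ n))
enumℤ-indexℤ -[1+ zero ]  = refl
enumℤ-indexℤ -[1+ suc n ] = cong awayFromZero (enumℤ-indexℤ -[1+ n ])

sparse-powers-without-prime-shift :
  1 < a → (∀ n L → ∃ λ k → L ≤ k × ¬ IsPrimeℤ (+ (a ^ k) ℤ.+ n)) →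
  (f : ℕ → ℕ) → NonDecreasing f → Unbounded f →
  ∃ λ (A : SetN) → PositiveSet A × SubsetOfPowers a A × CountBounded A f ×
    ¬ (∃ λ (n : ℤ) → ShiftIntoPrimes A n)
sparse-powers-without-prime-shift {a} 1<a shift-not-prime f f-mono f-unbounded
  with k , k-inc , N≤k , shift-not-prime-at
         ← increasing-choice (shift-not-prime ∘ enumℤ) (proj₁ ∘ f-unbounded)
  = range g , positive , ⊆powers , bounded , no-prime-shift
  where
  N : ℕ → ℕ
  N j = proj₁ (f-unbounded j)

  1≤N : ∀ j → 1 ≤ N j
  1≤N j = proj₁ (proj₂ (f-unbounded j))

  j<f[N] : ∀ j → j < f (N j)
  j<f[N] j = proj₂ (proj₂ (f-unbounded j))

  instance _ = >-nonZero (<-trans z<s 1<a)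

  g : ℕ → ℕ
  g j = a ^ k j

  g-inc : ∀ j → g j < g (suc j)
  g-inc j = ^-monoʳ-< a 1<a (k-inc j)

  positive : PositiveSet (range g)
  positive = ¬-not λ 0∈ → let j , gj≡0 = range-sound g 0∈ in
                            <-irrefl (sym gj≡0) (m^n>0 a (k j))

  ⊆powers : SubsetOfPowers a (range g)
  ⊆powers x x∈ = let j , gj≡x = range-sound g x∈ in
                   k j , ≤-trans (1≤N j) (N≤k j) , sym gj≡x

  bounded : CountBounded (range g) f
  bounded = count-bounded-by-members f-mono members
    where
    members : ∀ x → range g x ≡ true → count (range g) x ≤ f x
    members x x∈ with j , refl ← range-sound g x∈ = begin
      count (range g) (g j)   ≤⟨ count-range g-inc (g-inc j) ⟩
      suc j                   ≤⟨ j<f[N] j ⟩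
      f (N j)                 ≤⟨ f-mono _ _ (1≤N j) (≤-trans (N≤k j) (<⇒≤ (n<m^n 1<a (k j)))) ⟩
      f (g j)                 ∎
      where open ≤-Reasoning

  no-prime-shift : ¬ (∃ λ (n : ℤ) → ShiftIntoPrimes (range g) n)
  no-prime-shift (n , into-primes) =
    shift-not-prime-at j (subst (λ m → IsPrimeℤ (+ g j ℤ.+ m)) (sym (enumℤ-indexℤ n))
                                (into-primes (g j) (range-complete g-inc j)))
    where
    j : ℕ
    j = indexℤ n

theorem1 : (a : ℕ) → 1 ≤ a → PrimRootInfOften a →
    ((f : ℕ → ℕ) → NonDecreasing f → Unbounded f →
      ∃ λ (A : SetN) → PositiveSet A × SubsetOfPowers a A × CountBounded A f ×
        ¬ (∃ λ (n : ℤ) → ShiftIntoPrimes A n))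
    ×
    ¬ (∃ λ (f : ℕ → ℕ) → NonDecreasing f × Unbounded f ×
        ((A : SetN) → PositiveSet A → Admissible A → CountBounded A f →
          ∃ λ (n : ℤ) → ShiftIntoPrimes A n))
theorem1 a 1≤a roots = sparse-powers-without-prime-shift 1<a shifts
                     , λ (f , f-mono , f-unbounded , shiftable) →
                         let A , positive , ⊆powers , bounded , no-prime-shift =
                               sparse-powers-without-prime-shift 1<a shifts f f-mono f-unbounded
                         in no-prime-shift (shiftable A positive (powers-admissible ⊆powers) bounded)
  where
  1<a : 1 < a
  1<a = primRootInfOften⇒1<a 1≤a roots

  shifts : ∀ n L → ∃ λ k → L ≤ k × ¬ IsPrimeℤ (+ (a ^ k) ℤ.+ n)
  shifts = power-shift-not-prime 1<a roots
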